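{- There is no distinct covering system whose least modulus is $4$ and whose moduli have least common multiple $240$.
   Context: A covering system (covering) is a finite set of congruences $\{x \equiv r_i \pmod{n_i}\}$ with positive integer moduli such that every integer satisfies at least one of them. A covering is distinct if its moduli are pairwise distinct and greater than $1$. -}

module Defs where

open import Data.Nat as ℕ using (ℕ; _<_; _≤_)
open import Data.Nat.LCM using (lcm)
open import Data.Integer as ℤ using (ℤ; +_)
open import Data.Integer.Divisibility as ℤD using ()
open import Data.Product using (_×_; _,_; proj₁)
open import Data.List using (List; map; foldr)
open import Data.List.Relation.Unary.All using (All)
open import Data.List.Relation.Unary.Any using (Any)
open import Data.List.Relation.Unary.Unique.Propositional using (Unique)
open import Data.List.Membership.Propositional using (_∈_)
open import Relation.Binary.PropositionalEquality using (_≡_)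

Congruence : Set
Congruence = ℕ × ℤ

modulus : Congruence → ℕ
modulus = proj₁

Satisfies : ℤ → Congruence → Set
Satisfies x (n , r) = (+ n) ℤD.∣ (x ℤ.- r)

moduli : List Congruence → List ℕ
moduli = map proj₁

IsCovering : List Congruence → Set
IsCovering cs = All (λ n → 0 < n) (moduli cs) × (∀ (x : ℤ) → Any (Satisfies x) cs)

IsDistinctCovering : List Congruence → Set
IsDistinctCovering cs =
  IsCovering cs × Unique (moduli cs) × All (λ n → 1 < n) (moduli cs)

LeastModulus : List Congruence → ℕ → Set
LeastModulus cs m = (m ∈ moduli cs) × All (λ n → m ≤ n) (moduli cs)

lcmModuli : List Congruence → ℕ
lcmModuli cs = foldr lcm 1 (moduli cs)

-- Every modulus divides 240 = 16 · 15 and is at least 4, so it is 2ʲ · s with s ∈ {1, 3, 5, 15};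
-- read an integer x through the pair (x mod 16, x mod 15).  A congruence modulo 2ʲ · s fixes the
-- last j binary digits of x mod 16 and one class modulo s of x mod 15.  Fix a residue mod 16, a
-- leaf of the binary tree of depth 4, and the b, c, e congruences with s = 3, 5, 15 whose binary
-- digits match it.  Without a congruence with s = 1 there, they cover ℤ/15 only if e ≥ (3 ∸ b)(5 ∸ c),
-- because by the Chinese remainder theorem that many classes mod 15 avoid all the classes mod 3 and
-- mod 5.  A finite search over the placements of the moduli 2ʲ · s with j ≥ 1 in the tree (crediting
-- every leaf with the moduli 5 and 15) shows that some leaf always fails this count; the integer
-- with that residue mod 16 and an uncovered residue mod 15 then satisfies no congruence.
module Submission where

open import Algebra.Properties.CommutativeSemigroup using (x∙yz≈y∙xz)
open import Data.Bool using (Bool; true; false; T; not; _∧_; _∨_; if_then_else_)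
import Data.Bool.Properties as Bool
open import Data.Bool.Properties using (T-∧; T-∨; T-≡)
open import Data.Empty using (⊥-elim)
open import Data.Fin using (Fin; toℕ)
open import Data.Fin.Properties using (¬∀⟶∃¬; toℕ<n; fromℕ<-cong; fromℕ<-toℕ)
open import Data.Fin.Subset as Subset using (Subset; inside; outside; ⁅_⁆; _∪_; ∁; ∣_∣)
  renaming (_∈_ to _∈ₛ_; _∉_ to _∉ₛ_)
open import Data.Fin.Subset.Properties
  using (anySubset?; ∣⊥∣≡0; ∣⁅x⁆∣≡1; p⊆q⇒∣p∣≤∣q∣; x∈⁅x⁆; x∈p∪q⁺; ∣∁p∣≡n∸∣p∣; x∈∁p⇒x∉p)
  renaming (_∈?_ to _∈ₛ?_)
open import Data.Integer as ℤ using (ℤ; _⊖_)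
open import Data.Integer.DivMod using (_%ℕ_; _/ℕ_; a≡a%ℕn+[a/ℕn]*n)
open import Data.Integer.Divisibility.Signed using (∣ᵤ⇒∣; ∣⇒∣ᵤ; ∣m∣n⇒∣m+n; ∣n⇒∣m*n) renaming (_∣_ to _∣ℤ_)
open import Data.Integer.Properties using (⊖-≥; ∣⊖∣-<; m-n≡m⊖n)
import Data.Integer.Tactic.RingSolver as ℤ-Ring
open import Data.List using (List; []; _∷_; _++_; map; foldr; length; replicate)
open import Data.List.Membership.Propositional using (_∈_; find)
open import Data.List.Membership.Propositional.Properties using (∈-map⁺; ∈-map⁻; ∈-++⁺ˡ; ∈-++⁺ʳ)
open import Data.List.Properties using (length-++; length-replicate)
open import Data.List.Relation.Unary.All as All using (All; []; _∷_)
open import Data.List.Relation.Unary.All.Properties using (++⁺)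
open import Data.List.Relation.Unary.AllPairs using (_∷_)
open import Data.List.Relation.Unary.Any using (here; there)
open import Data.List.Relation.Unary.Unique.Propositional using (Unique)
open import Data.Maybe as Maybe using (Maybe; just; nothing)
open import Data.Nat
  using (ℕ; zero; suc; _+_; _*_; _^_; _∸_; _≤_; _<_; _≤?_; _≤ᵇ_; _≡ᵇ_; _%_; _/_; NonZero; >-nonZero; z≤n; s≤s)
open import Data.Nat.DivMod
  using (_mod_; m*n%n≡0; m*n/n≡m; [m+kn]%n≡m%n; +-distrib-/-∣ʳ; %-remove-+ʳ; m≡m%n+[m/n]*n; m∣n⇒o%n%m≡o%m;
         m<n⇒m%n≡m; n%1≡0)
open import Data.Nat.Divisibility using (_∣_; _∣?_; divides; ∣-trans; n∣m*n; ∣⇒≤)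
open import Data.Nat.LCM using (m∣lcm[m,n]; n∣lcm[m,n])
open import Data.Nat.Properties
  using (_≟_; ≤-refl; ≤-reflexive; ≤-trans; <⇒≤; <⇒≱; ≰⇒>; ≤-<-connex; m≤n⇒m≤1+n; m≤n+m;
         +-suc; +-assoc; +-identityʳ; +-monoʳ-≤; *-mono-≤; ∸-monoʳ-≤; m+[n∸m]≡n; ≤ᵇ⇒≤; ≤⇒≤ᵇ;
         +-commutativeSemigroup; allUpTo?; module ≤-Reasoning)
import Data.Nat.Tactic.RingSolver as ℕ-Ring
open import Data.List.Membership.DecPropositional _≟_ using (_∈?_)
open import Data.Product using (∃; _×_; _,_; proj₁; proj₂)
open import Data.Sum using (_⊎_; inj₁; inj₂)
open import Data.Unit using (⊤)
open import Data.Vec as Vec using (Vec; []; _∷_; tabulate; lookup)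
open import Data.Vec.Properties using (lookup∘tabulate; lookup⇒[]=; []=⇒lookup)
open import Defs
open import Function using (_∘_)
open import Function.Bundles using (Equivalence)
open import Relation.Binary.PropositionalEquality
  using (_≡_; _≢_; refl; sym; trans; cong; cong₂; subst; subst₂; module ≡-Reasoning)
open import Relation.Nullary using (¬_; Dec; ¬?; _→-dec_; contradiction)
open import Relation.Nullary.Decidable using (does; map′; decidable-stable; toWitness; from-yes; dec-true; dec-false)

-- Binary digits, least significant first

toBits : (d : ℕ) → ℕ → Vec Bool d
toBits zero    x = []
toBits (suc d) x = (x % 2 ≡ᵇ 1) ∷ toBits d (x / 2)

fromBits : ∀ {d} → Vec Bool d → ℕ
fromBits []          = 0
fromBits (false ∷ v) = fromBits v * 2
fromBits (true  ∷ v) = suc (fromBits v * 2)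

_≼ᵇ_ : ∀ {m n} → Vec Bool m → Vec Bool n → Bool
[]      ≼ᵇ _       = true
(_ ∷ _) ≼ᵇ []      = false
(x ∷ p) ≼ᵇ (y ∷ l) = does (x Bool.≟ y) ∧ p ≼ᵇ l

toBits-+* : ∀ d x k → toBits d (x + k * 2 ^ d) ≡ toBits d x
toBits-+* zero    x k = refl
toBits-+* (suc d) x k =
  cong₂ _∷_ (cong (_≡ᵇ 1) (trans (cong (λ m → (x + m) % 2) shape) ([m+kn]%n≡m%n x (k * 2 ^ d) 2)))
            (trans (cong (toBits d) half) (toBits-+* d (x / 2) k))
  where
  regroup : ∀ k p → k * (2 * p) ≡ k * p * 2
  regroup = ℕ-Ring.solve-∀
  shape : k * 2 ^ suc d ≡ k * 2 ^ d * 2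
  shape = regroup k (2 ^ d)
  half : (x + k * 2 ^ suc d) / 2 ≡ x / 2 + k * 2 ^ d
  half = trans (cong (λ m → (x + m) / 2) shape)
    (trans (+-distrib-/-∣ʳ x (n∣m*n (k * 2 ^ d))) (cong (λ m → x / 2 + m) (m*n/n≡m (k * 2 ^ d) 2)))

toBits-fromBits : ∀ {d} (v : Vec Bool d) → toBits d (fromBits v) ≡ v
toBits-fromBits []          = refl
toBits-fromBits (false ∷ v) =
  cong₂ _∷_ (cong (_≡ᵇ 1) (m*n%n≡0 (fromBits v) 2))
            (trans (cong (toBits _) (m*n/n≡m (fromBits v) 2)) (toBits-fromBits v))
toBits-fromBits (true  ∷ v) =
  cong₂ _∷_ (cong (_≡ᵇ 1) ([m+kn]%n≡m%n 1 (fromBits v) 2))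
            (trans (cong (toBits _) half) (toBits-fromBits v))
  where
  half : suc (fromBits v * 2) / 2 ≡ fromBits v
  half = trans (+-distrib-/-∣ʳ 1 {d = 2} (n∣m*n (fromBits v))) (m*n/n≡m (fromBits v) 2)

≟-refl : ∀ b → T (does (b Bool.≟ b))
≟-refl false = _
≟-refl true  = _

toBits-≼ : ∀ {d e} x → d ≤ e → T (toBits d x ≼ᵇ toBits e x)
toBits-≼ x z≤n       = _
toBits-≼ x (s≤s d≤e) = Equivalence.from T-∧ (≟-refl (x % 2 ≡ᵇ 1) , toBits-≼ (x / 2) d≤e)

-- Tallies of congruences by odd part

data OddPart : Set where
  one three five fifteen : OddPart

value : OddPart → ℕ
value one     = 1
value three   = 3
value five    = 5
value fifteen = 15

δ : OddPart → OddPart → ℕ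
δ one     one     = 1
δ three   three   = 1
δ five    five    = 1
δ fifteen fifteen = 1
δ _       _       = 0

record Tally : Set where
  constructor tally
  field
    ones threes fives fifteens : ℕ

count : OddPart → Tally → ℕ
count one     = Tally.ones
count three   = Tally.threes
count five    = Tally.fives
count fifteen = Tally.fifteens

∅ : Tally
∅ = tally 0 0 0 0

count-∅ : ∀ s → count s ∅ ≡ 0
count-∅ one     = refl
count-∅ three   = refl
count-∅ five    = refl
count-∅ fifteen = refl

bump : Tally → OddPart → Tally
bump k t =
  tally (δ one t + count one k) (δ three t + count three k) (δ five t + count five k) (δ fifteen t + count fifteen k)

count-bump : ∀ s k t → count s (bump k t) ≡ δ s t + count s k
count-bump one     k t = refl
count-bump three   k t = refl
count-bump five    k t = refl
count-bump fifteen k t = refl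

tally-ext : ∀ {k k'} → (∀ s → count s k ≡ count s k') → k ≡ k'
tally-ext {tally _ _ _ _} {tally _ _ _ _} eq with eq one | eq three | eq five | eq fifteen
... | refl | refl | refl | refl = refl

bump-comm : ∀ k s t → bump (bump k s) t ≡ bump (bump k t) s
bump-comm k s t = tally-ext λ c → begin
  count c (bump (bump k s) t)   ≡⟨ count-bump c (bump k s) t ⟩
  δ c t + count c (bump k s)    ≡⟨ cong (λ n → δ c t + n) (count-bump c k s) ⟩
  δ c t + (δ c s + count c k)   ≡⟨ x∙yz≈y∙xz +-commutativeSemigroup (δ c t) (δ c s) (count c k) ⟩
  δ c s + (δ c t + count c k)   ≡⟨ cong (λ n → δ c s + n) (count-bump c k t) ⟨
  δ c s + count c (bump k t)    ≡⟨ count-bump c (bump k t) s ⟨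
  count c (bump (bump k t) s)   ∎
  where open ≡-Reasoning

infix 4 _≤ᵀ_
_≤ᵀ_ : Tally → Tally → Set
k ≤ᵀ k' = ∀ s → count s k ≤ count s k'

≤ᵀ-refl : ∀ {k} → k ≤ᵀ k
≤ᵀ-refl s = ≤-refl

≤ᵀ-trans : ∀ {k k' k''} → k ≤ᵀ k' → k' ≤ᵀ k'' → k ≤ᵀ k''
≤ᵀ-trans p q s = ≤-trans (p s) (q s)

bump-mono : ∀ {k k'} t → k ≤ᵀ k' → bump k t ≤ᵀ bump k' t
bump-mono {k} {k'} t p s = subst₂ _≤_ (sym (count-bump s k t)) (sym (count-bump s k' t)) (+-monoʳ-≤ (δ s t) (p s))

≤ᵀ-bump : ∀ k t → k ≤ᵀ bump k t
≤ᵀ-bump k t s = subst (count s k ≤_) (sym (count-bump s k t)) (m≤n+m (count s k) (δ s t))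

feasible : Tally → Bool
feasible k = (1 ≤ᵇ count one k) ∨ ((3 ∸ count three k) * (5 ∸ count five k) ≤ᵇ count fifteen k)

feasible-mono : ∀ {k k'} → k ≤ᵀ k' → T (feasible k) → T (feasible k')
feasible-mono {k} {k'} k≤k' ok with Equivalence.to T-∨ ok
... | inj₁ some-one = Equivalence.from T-∨ (inj₁ (≤⇒≤ᵇ (≤-trans (≤ᵇ⇒≤ 1 _ some-one) (k≤k' one))))
... | inj₂ enough   = Equivalence.from T-∨ (inj₂ (≤⇒≤ᵇ (≤-trans fewer-missing (≤-trans (≤ᵇ⇒≤ _ _ enough) (k≤k' fifteen)))))
  where
  fewer-missing = *-mono-≤ (∸-monoʳ-≤ 3 (k≤k' three)) (∸-monoʳ-≤ 5 (k≤k' five))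

-- Covering ℤ/15 by residue classes modulo 1, 3, 5 and 15

∣p∪q∣≤∣p∣+∣q∣ : ∀ {n} (p q : Subset n) → ∣ p ∪ q ∣ ≤ ∣ p ∣ + ∣ q ∣
∣p∪q∣≤∣p∣+∣q∣ []            []            = z≤n
∣p∪q∣≤∣p∣+∣q∣ (inside  ∷ p) (s       ∷ q) = s≤s (≤-trans (∣p∪q∣≤∣p∣+∣q∣ p q) (+-monoʳ-≤ ∣ p ∣ (∣q∣≤∣s∷q∣ s)))
  where
  ∣q∣≤∣s∷q∣ : ∀ s → ∣ q ∣ ≤ ∣ s ∷ q ∣
  ∣q∣≤∣s∷q∣ inside  = m≤n⇒m≤1+n ≤-refl
  ∣q∣≤∣s∷q∣ outside = ≤-refl
∣p∪q∣≤∣p∣+∣q∣ (outside ∷ p) (inside  ∷ q) =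
  subst (suc ∣ p ∪ q ∣ ≤_) (sym (+-suc ∣ p ∣ ∣ q ∣)) (s≤s (∣p∪q∣≤∣p∣+∣q∣ p q))
∣p∪q∣≤∣p∣+∣q∣ (outside ∷ p) (outside ∷ q) = ∣p∪q∣≤∣p∣+∣q∣ p q

residueClasses : ∀ n .{{_ : NonZero n}} → List ℕ → Subset n
residueClasses n = foldr (λ ρ H → ⁅ ρ mod n ⁆ ∪ H) Subset.⊥

∣residueClasses∣≤length : ∀ n .{{_ : NonZero n}} R → ∣ residueClasses n R ∣ ≤ length R
∣residueClasses∣≤length n []      = ≤-reflexive (∣⊥∣≡0 n)
∣residueClasses∣≤length n (ρ ∷ R) =
  ≤-trans (∣p∪q∣≤∣p∣+∣q∣ ⁅ ρ mod n ⁆ (residueClasses n R))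
          (subst (_≤ suc (length R)) (sym (cong (_+ _) (∣⁅x⁆∣≡1 (ρ mod n)))) (s≤s (∣residueClasses∣≤length n R)))

∉residueClasses : ∀ {n} .{{_ : NonZero n}} m R → m mod n ∉ₛ residueClasses n R → All (λ ρ → m % n ≢ ρ % n) R
∉residueClasses m []      _  = []
∉residueClasses {n} m (ρ ∷ R) m∉ =
  (λ eq → m∉ (x∈p∪q⁺ (inj₁ (subst (_∈ₛ ⁅ ρ mod n ⁆) (sym (fromℕ<-cong _ _ eq _ _)) (x∈⁅x⁆ (ρ mod n))))))
  ∷ ∉residueClasses m R (λ m∈ → m∉ (x∈p∪q⁺ (inj₂ m∈)))

∀Subset? : ∀ {n} {P : Subset n → Set} → (∀ p → Dec (P p)) → Dec (∀ p → P p)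
∀Subset? P? = map′ (λ ∄¬P p → decidable-stable (P? p) (λ ¬Pp → ∄¬P (p , ¬Pp))) (λ ∀P (p , ¬Pp) → ¬Pp (∀P p))
                   (¬? (anySubset? (λ p → ¬? (P? p))))

escapeSet : Subset 3 → Subset 5 → Subset 15
escapeSet A B = tabulate λ u → lookup (∁ A) (toℕ u mod 3) ∧ lookup (∁ B) (toℕ u mod 5)

∈escapeSet : ∀ {A B} u → u ∈ₛ escapeSet A B → toℕ u mod 3 ∉ₛ A × toℕ u mod 5 ∉ₛ B
∈escapeSet {A} {B} u u∈ =
  let in∁A , in∁B = Equivalence.to T-∧ (Equivalence.from T-≡ (trans (sym (lookup∘tabulate escapes u)) ([]=⇒lookup u∈)))
  in  x∈∁p⇒x∉p (lookup⇒[]= _ (∁ A) (Equivalence.to T-≡ in∁A)) , x∈∁p⇒x∉p (lookup⇒[]= _ (∁ B) (Equivalence.to T-≡ in∁B))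
  where
  escapes = λ v → lookup (∁ A) (toℕ v mod 3) ∧ lookup (∁ B) (toℕ v mod 5)

-- The Chinese remainder theorem for ℤ/15 ≅ ℤ/3 × ℤ/5, checked on all 2³ · 2⁵ pairs of subsets.
∣escapeSet∣ : ∀ A B → ∣ escapeSet A B ∣ ≡ ∣ ∁ A ∣ * ∣ ∁ B ∣
∣escapeSet∣ = toWitness {a? = ∀Subset? λ A → ∀Subset? λ B → ∣ escapeSet A B ∣ ≟ ∣ ∁ A ∣ * ∣ ∁ B ∣} _

uncovered-mod15 : ∀ R₃ R₅ R₁₅ → length R₁₅ < (3 ∸ length R₃) * (5 ∸ length R₅) →
  ∃ λ u → u < 15 × All (λ ρ → u % 3 ≢ ρ % 3) R₃ × All (λ ρ → u % 5 ≢ ρ % 5) R₅ × All (λ ρ → u % 15 ≢ ρ % 15) R₁₅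
uncovered-mod15 R₃ R₅ R₁₅ few =
  toℕ u , toℕ<n u , ∉residueClasses (toℕ u) R₃ (proj₁ u∉A×B) , ∉residueClasses (toℕ u) R₅ (proj₂ u∉A×B) ,
  ∉residueClasses (toℕ u) R₁₅ (λ u∈C → u∉C (subst (_∈ₛ C) (toℕ-mod15 u) u∈C))
  where
  A = residueClasses 3 R₃
  B = residueClasses 5 R₅
  C = residueClasses 15 R₁₅
  E = escapeSet A B
  ∣C∣<∣E∣ : ∣ C ∣ < ∣ E ∣
  ∣C∣<∣E∣ = begin-strict
    ∣ C ∣                               ≤⟨ ∣residueClasses∣≤length 15 R₁₅ ⟩
    length R₁₅                          <⟨ few ⟩
    (3 ∸ length R₃) * (5 ∸ length R₅)   ≤⟨ *-mono-≤ (∸-monoʳ-≤ 3 (∣residueClasses∣≤length 3 R₃))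
                                                      (∸-monoʳ-≤ 5 (∣residueClasses∣≤length 5 R₅)) ⟩
    (3 ∸ ∣ A ∣) * (5 ∸ ∣ B ∣)           ≡⟨ sym (cong₂ _*_ (∣∁p∣≡n∸∣p∣ A) (∣∁p∣≡n∸∣p∣ B)) ⟩
    ∣ ∁ A ∣ * ∣ ∁ B ∣                   ≡⟨ sym (∣escapeSet∣ A B) ⟩
    ∣ E ∣                               ∎
    where open ≤-Reasoning
  E⊈C : ∃ λ u → ¬ (u ∈ₛ E → u ∈ₛ C)
  E⊈C = ¬∀⟶∃¬ 15 (λ u → u ∈ₛ E → u ∈ₛ C) (λ u → u ∈ₛ? E →-dec u ∈ₛ? C)
                  (λ E⊆C → <⇒≱ ∣C∣<∣E∣ (p⊆q⇒∣p∣≤∣q∣ (E⊆C _)))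
  u = proj₁ E⊈C
  u∈E : u ∈ₛ E
  u∈E = decidable-stable (u ∈ₛ? E) (λ u∉E → proj₂ E⊈C (λ u∈E → contradiction u∈E u∉E))
  u∉A×B = ∈escapeSet {A} {B} u u∈E
  u∉C : u ∉ₛ C
  u∉C u∈C = proj₂ E⊈C (λ _ → u∈C)
  toℕ-mod15 : ∀ (v : Fin 15) → toℕ v mod 15 ≡ v
  toℕ-mod15 v = trans (fromℕ<-cong _ _ (m<n⇒m%n≡m (toℕ<n v)) _ (toℕ<n v)) (fromℕ<-toℕ v (toℕ<n v))

Pin : Set
Pin = OddPart × ℕ

Avoids : ℕ → Pin → Set
Avoids u (one     , ρ) = u % 1 ≢ ρ % 1
Avoids u (three   , ρ) = u % 3 ≢ ρ % 3
Avoids u (five    , ρ) = u % 5 ≢ ρ % 5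
Avoids u (fifteen , ρ) = u % 15 ≢ ρ % 15

addPins : Tally → List Pin → Tally
addPins k []             = k
addPins k ((t , _) ∷ ps) = addPins (bump k t) ps

addPins-++ : ∀ k ps qs → addPins k (ps ++ qs) ≡ addPins (addPins k ps) qs
addPins-++ k []             qs = refl
addPins-++ k ((t , _) ∷ ps) qs = addPins-++ (bump k t) ps qs

residues : OddPart → List Pin → List ℕ
residues s []             = []
residues s ((t , ρ) ∷ ps) = replicate (δ s t) ρ ++ residues s ps

count-addPins : ∀ s k ps → count s (addPins k ps) ≡ length (residues s ps) + count s k
count-addPins s k []             = refl
count-addPins s k ((t , ρ) ∷ ps) = begin
  count s (addPins (bump k t) ps)                            ≡⟨ count-addPins s (bump k t) ps ⟩
  length (residues s ps) + count s (bump k t)                ≡⟨ cong (λ n → length (residues s ps) + n) (count-bump s k t) ⟩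
  length (residues s ps) + (δ s t + count s k)               ≡⟨ x∙yz≈y∙xz +-commutativeSemigroup _ (δ s t) (count s k) ⟩
  δ s t + (length (residues s ps) + count s k)               ≡⟨ +-assoc (δ s t) _ _ ⟨
  δ s t + length (residues s ps) + count s k                 ≡⟨ cong (_+ count s k) length-cons ⟨
  length (replicate (δ s t) ρ ++ residues s ps) + count s k  ∎
  where
  open ≡-Reasoning
  length-cons : length (replicate (δ s t) ρ ++ residues s ps) ≡ δ s t + length (residues s ps)
  length-cons = trans (length-++ (replicate (δ s t) ρ)) (cong (_+ length (residues s ps)) (length-replicate (δ s t)))

avoidsAll : ∀ {u} ps → All (λ ρ → u % 1 ≢ ρ % 1) (residues one ps) → All (λ ρ → u % 3 ≢ ρ % 3) (residues three ps) →
  All (λ ρ → u % 5 ≢ ρ % 5) (residues five ps) → All (λ ρ → u % 15 ≢ ρ % 15) (residues fifteen ps) → All (Avoids u) ps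
avoidsAll []                   _        _        _        _        = []
avoidsAll ((one     , ρ) ∷ ps) (a ∷ as) bs       cs       ds       = a ∷ avoidsAll ps as bs cs ds
avoidsAll ((three   , ρ) ∷ ps) as       (b ∷ bs) cs       ds       = b ∷ avoidsAll ps as bs cs ds
avoidsAll ((five    , ρ) ∷ ps) as       bs       (c ∷ cs) ds       = c ∷ avoidsAll ps as bs cs ds
avoidsAll ((fifteen , ρ) ∷ ps) as       bs       cs       (d ∷ ds) = d ∷ avoidsAll ps as bs cs ds

infeasible⇒escape : ∀ ps → ¬ T (feasible (addPins ∅ ps)) → ∃ λ u → u < 15 × All (Avoids u) ps
infeasible⇒escape ps infeasible =
  let u , u<15 , as₃ , as₅ , as₁₅ = uncovered-mod15 (residues three ps) (residues five ps) (residues fifteen ps) fewFifteens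
  in  u , u<15 , avoidsAll ps (vacuous (residues one ps) noOnes) as₃ as₅ as₁₅
  where
  len : ∀ s → length (residues s ps) ≡ count s (addPins ∅ ps)
  len s = sym (trans (count-addPins s ∅ ps) (trans (cong (λ n → length (residues s ps) + n) (count-∅ s)) (+-identityʳ _)))
  fewFifteens : length (residues fifteen ps) < (3 ∸ length (residues three ps)) * (5 ∸ length (residues five ps))
  fewFifteens = subst₂ _<_ (sym (len fifteen)) (sym (cong₂ (λ b c → (3 ∸ b) * (5 ∸ c)) (len three) (len five)))
                       (≰⇒> (infeasible ∘ Equivalence.from T-∨ ∘ inj₂ ∘ ≤⇒≤ᵇ))
  noOnes : length (residues one ps) < 1
  noOnes = subst (_< 1) (sym (len one)) (≰⇒> (infeasible ∘ Equivalence.from T-∨ ∘ inj₁ ∘ ≤⇒≤ᵇ))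
  vacuous : ∀ {P : ℕ → Set} R → length R < 1 → All P R
  vacuous []      _       = []
  vacuous (_ ∷ _) (s≤s ())

-- Placing congruences modulo 2ʲ · s in the binary tree of residues modulo 16

-- A slot of level r and kind s is the modulus 2ʳ⁺¹ · s, whose congruence sits r + 1 levels below the
-- current node; its Path is the residue modulo 2ʳ⁺¹, and a Placement assigns nothing to unused moduli.
record Slot : Set where
  constructor slot
  field
    level : ℕ
    kind  : OddPart
open Slot

Path : Slot → Set
Path m = Vec Bool (suc (level m))

Placement : List Slot → Set
Placement = All (λ m → Maybe (Path m))

applies : ∀ {n f} → Maybe (Vec Bool n) → Vec Bool f → Bool
applies nothing  _ = false
applies (just p) l = p ≼ᵇ l

step : ∀ {n f} → OddPart → Maybe (Vec Bool n) → Vec Bool f → Tally → Tally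
step t q l k = if applies q l then bump k t else k

tallyAt : ∀ {f} (S : List Slot) → Placement S → Vec Bool f → Tally → Tally
tallyAt []      []      l k = k
tallyAt (m ∷ S) (q ∷ P) l k = tallyAt S P l (step (kind m) q l k)

InfeasibleLeaf : ∀ f → (Vec Bool f → Tally) → Set
InfeasibleLeaf f tallyOf = ∃ λ (l : Vec Bool f) → ¬ T (feasible (tallyOf l))

Uncoverable : ℕ → Tally → List Slot → Set
Uncoverable f k S = (P : Placement S) → InfeasibleLeaf f λ l → tallyAt S P l k

bumpAll : Tally → List Slot → Tally
bumpAll k []      = k
bumpAll k (m ∷ S) = bumpAll (bump k (kind m)) S

bumpNext : Tally → List Slot → Tally
bumpNext k []                   = k
bumpNext k (slot zero t ∷ S)    = bumpNext (bump k t) S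
bumpNext k (slot (suc _) _ ∷ S) = bumpNext k S

descend : List Slot → List Slot
descend []                   = []
descend (slot zero _ ∷ S)    = descend S
descend (slot (suc r) t ∷ S) = slot r t ∷ descend S

-- uncoverableSplit f k L R rest: the slots of L go to the left subtree (next digit false), those of R
-- to the right one, and every way of distributing rest leaves an infeasible leaf.  Sending all of rest
-- to one side only helps that side, so a side that fails even then settles the question.
uncoverable : ℕ → Tally → List Slot → Bool
uncoverableSplit : ℕ → Tally → List Slot → List Slot → List Slot → Bool
uncoverableRefine : ℕ → Tally → List Slot → List Slot → List Slot → Bool

uncoverable zero    k S = not (feasible k)
uncoverable (suc f) k S =
  if feasible k then false else if feasible (bumpAll k S) then uncoverableSplit f k [] [] S else true

uncoverableSplit f k L R rest =
  uncoverable f (bumpNext k (L ++ rest)) (descend (L ++ rest)) ∨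
  uncoverable f (bumpNext k (R ++ rest)) (descend (R ++ rest)) ∨
  uncoverableRefine f k L R rest

uncoverableRefine f k L R []         = false
uncoverableRefine f k L R (m ∷ rest) = uncoverableSplit f k (m ∷ L) R rest ∧ uncoverableSplit f k L (m ∷ R) rest

step-bump : ∀ {n f} s (q : Maybe (Vec Bool n)) (l : Vec Bool f) k t → step s q l (bump k t) ≡ bump (step s q l k) t
step-bump s q l k t with applies q l
... | true  = bump-comm k t s
... | false = refl

tallyAt-bump : ∀ {f} S (P : Placement S) (l : Vec Bool f) k t → tallyAt S P l (bump k t) ≡ bump (tallyAt S P l k) t
tallyAt-bump []      []      l k t = refl
tallyAt-bump (m ∷ S) (q ∷ P) l k t =
  trans (cong (tallyAt S P l) (step-bump (kind m) q l k t)) (tallyAt-bump S P l (step (kind m) q l k) t)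

tallyAt-step : ∀ {n f g} S (P : Placement S) (l : Vec Bool f) t (q : Maybe (Vec Bool n)) (l' : Vec Bool g) k →
  tallyAt S P l (step t q l' k) ≡ step t q l' (tallyAt S P l k)
tallyAt-step S P l t q l' k with applies q l'
... | true  = tallyAt-bump S P l k t
... | false = refl

step-mono : ∀ {n f n' f'} t (q : Maybe (Vec Bool n)) (l : Vec Bool f) (q' : Maybe (Vec Bool n')) (l' : Vec Bool f') {k k'} →
  applies q l ≡ applies q' l' → k ≤ᵀ k' → step t q l k ≤ᵀ step t q' l' k'
step-mono t q l q' l' same k≤k' with applies q l | applies q' l'
step-mono t q l q' l' refl k≤k' | true  | true  = bump-mono t k≤k'
step-mono t q l q' l' refl k≤k' | false | false = k≤k'

step≤bump : ∀ {n f} t (q : Maybe (Vec Bool n)) (l : Vec Bool f) {k k'} → k ≤ᵀ k' → step t q l k ≤ᵀ bump k' t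
step≤bump t q l k≤k' with applies q l
... | true  = bump-mono t k≤k'
... | false = ≤ᵀ-trans k≤k' (≤ᵀ-bump _ t)

tallyAt-mono : ∀ {f} S (P : Placement S) (l : Vec Bool f) {k k'} → k ≤ᵀ k' → tallyAt S P l k ≤ᵀ tallyAt S P l k'
tallyAt-mono []      []      l k≤k' = k≤k'
tallyAt-mono (m ∷ S) (q ∷ P) l k≤k' = tallyAt-mono S P l (step-mono (kind m) q l q l refl k≤k')

tallyAt≤bumpAll : ∀ {f} S (P : Placement S) (l : Vec Bool f) {k k'} → k ≤ᵀ k' → tallyAt S P l k ≤ᵀ bumpAll k' S
tallyAt≤bumpAll []      []      l k≤k' = k≤k'
tallyAt≤bumpAll (m ∷ S) (q ∷ P) l k≤k' = tallyAt≤bumpAll S P l (step≤bump (kind m) q l k≤k')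

tallyAt-[] : ∀ S (P : Placement S) k → tallyAt S P [] k ≡ k
tallyAt-[] []      []                 k = refl
tallyAt-[] (m ∷ S) (nothing      ∷ P) k = tallyAt-[] S P k
tallyAt-[] (m ∷ S) (just (_ ∷ _) ∷ P) k = tallyAt-[] S P k

tallyAt-++ : ∀ {f} L R (PL : Placement L) (PR : Placement R) (l : Vec Bool f) k →
  tallyAt (L ++ R) (++⁺ PL PR) l k ≡ tallyAt R PR l (tallyAt L PL l k)
tallyAt-++ []      R []       PR l k = refl
tallyAt-++ (m ∷ L) R (q ∷ PL) PR l k = tallyAt-++ L R PL PR l (step (kind m) q l k)

Off : Bool → ∀ {n} → Maybe (Vec Bool (suc n)) → Set
Off b nothing        = ⊤
Off b (just (x ∷ _)) = x ≢ b

AllOff : Bool → ∀ {S} → Placement S → Set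
AllOff b []      = ⊤
AllOff b (q ∷ P) = Off b q × AllOff b P

applies-off : ∀ {n f} b (q : Maybe (Vec Bool (suc n))) (l : Vec Bool f) → Off b q → applies q (b ∷ l) ≡ false
applies-off b nothing        l _   = refl
applies-off b (just (x ∷ _)) l x≢b rewrite dec-false (x Bool.≟ b) x≢b = refl

tallyAt-off : ∀ {f} b S (P : Placement S) (l : Vec Bool f) k → AllOff b P → tallyAt S P (b ∷ l) k ≡ k
tallyAt-off b []      []      l k _            = refl
tallyAt-off b (m ∷ S) (q ∷ P) l k (off , offs) rewrite applies-off b q l off = tallyAt-off b S P l k offs

restrict : ∀ {n} → Bool → Maybe (Vec Bool (suc n)) → Maybe (Vec Bool n)
restrict b nothing        = nothing
restrict b (just (x ∷ p)) = if does (x Bool.≟ b) then just p else nothing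

applies-restrict : ∀ {n f} b (q : Maybe (Vec Bool (suc n))) (l : Vec Bool f) → applies q (b ∷ l) ≡ applies (restrict b q) l
applies-restrict b nothing        l = refl
applies-restrict b (just (x ∷ p)) l with does (x Bool.≟ b)
... | true  = refl
... | false = refl

child : Bool → (S : List Slot) → Placement S → Placement (descend S)
child b []                []      = []
child b (slot zero    t ∷ S) (q ∷ P) = child b S P
child b (slot (suc r) t ∷ S) (q ∷ P) = restrict b q ∷ child b S P

bumpNext-bump : ∀ S k t → bumpNext (bump k t) S ≡ bump (bumpNext k S) t
bumpNext-bump []                   k t = refl
bumpNext-bump (slot zero    s ∷ S) k t = trans (cong (λ k' → bumpNext k' S) (bump-comm k t s)) (bumpNext-bump S (bump k s) t)
bumpNext-bump (slot (suc _) _ ∷ S) k t = bumpNext-bump S k t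

bumpNext-step : ∀ {n f} S t (q : Maybe (Vec Bool n)) (l : Vec Bool f) k → bumpNext (step t q l k) S ≡ step t q l (bumpNext k S)
bumpNext-step S t q l k with applies q l
... | true  = bumpNext-bump S k t
... | false = refl

tallyAt-child : ∀ {f} b S (P : Placement S) (l : Vec Bool f) {k k'} → k ≤ᵀ k' →
  tallyAt S P (b ∷ l) k ≤ᵀ tallyAt (descend S) (child b S P) l (bumpNext k' S)
tallyAt-child b []                   []      l k≤k' = k≤k'
tallyAt-child b (slot zero    t ∷ S) (q ∷ P) l k≤k' = tallyAt-child b S P l (step≤bump t q (b ∷ l) k≤k')
tallyAt-child b (slot (suc r) t ∷ S) (q ∷ P) l {k} {k'} k≤k' =
  subst (λ k'' → tallyAt S P (b ∷ l) (step t q (b ∷ l) k) ≤ᵀ tallyAt (descend S) (child b S P) l k'')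
        (bumpNext-step S t (restrict b q) l k')
        (tallyAt-child b S P l (step-mono t q (b ∷ l) (restrict b q) l (applies-restrict b q l) k≤k'))

off-either : ∀ {n} (q : Maybe (Vec Bool (suc n))) → Off true q ⊎ Off false q
off-either nothing            = inj₁ _
off-either (just (false ∷ _)) = inj₁ λ ()
off-either (just (true  ∷ _)) = inj₂ λ ()

T-not⇒¬T : ∀ {b} → T (not b) → ¬ T b
T-not⇒¬T {false} _ ()

-- The hypothesis is an equation rather than T (…) because Agda checks refl against it far faster.
uncoverable-sound : ∀ f k S → uncoverable f k S ≡ true → Uncoverable f k S
split-sound : ∀ f k L R rest → T (uncoverableSplit f k L R rest) →
  (PL : Placement L) (PR : Placement R) (Pr : Placement rest) → AllOff true PL → AllOff false PR →
  InfeasibleLeaf (suc f) λ l → tallyAt rest Pr l (tallyAt R PR l (tallyAt L PL l k))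
refine-sound : ∀ f k L R rest → T (uncoverableRefine f k L R rest) →
  (PL : Placement L) (PR : Placement R) (Pr : Placement rest) → AllOff true PL → AllOff false PR →
  InfeasibleLeaf (suc f) λ l → tallyAt rest Pr l (tallyAt R PR l (tallyAt L PL l k))
child-sound : ∀ f k b Z (PZ : Placement Z) → T (uncoverable f (bumpNext k Z) (descend Z)) →
  InfeasibleLeaf f λ l → tallyAt Z PZ (b ∷ l) k

uncoverable-sound zero    k S unc P =
  [] , subst (λ k' → ¬ T (feasible k')) (sym (tallyAt-[] S P k)) (T-not⇒¬T (Equivalence.from T-≡ unc))
uncoverable-sound (suc f) k S unc P with feasible k | feasible (bumpAll k S) in hopeless
... | true  | _     = ⊥-elim (Equivalence.from T-≡ unc)
... | false | false = Vec.replicate _ false , λ ok → subst T hopeless (feasible-mono (tallyAt≤bumpAll S P _ ≤ᵀ-refl) ok)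
... | false | true  = split-sound f k [] [] S (Equivalence.from T-≡ unc) [] [] P _ _

child-sound f k b Z PZ dead =
  let l , bad = uncoverable-sound f _ _ (Equivalence.to T-≡ dead) (child b Z PZ)
  in  l , bad ∘ feasible-mono (tallyAt-child b Z PZ l ≤ᵀ-refl)

split-sound f k L R rest unc PL PR Pr offL offR with Equivalence.to T-∨ unc
... | inj₁ leftDead =
  let l , bad = child-sound f k false (L ++ rest) (++⁺ PL Pr) leftDead
  in  false ∷ l , subst (λ k' → ¬ T (feasible k'))
        (trans (tallyAt-++ L rest PL Pr (false ∷ l) k)
               (cong (tallyAt rest Pr (false ∷ l)) (sym (tallyAt-off false R PR l _ offR)))) bad
... | inj₂ unc′ with Equivalence.to T-∨ unc′
...   | inj₁ rightDead =
  let l , bad = child-sound f k true (R ++ rest) (++⁺ PR Pr) rightDead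
  in  true ∷ l , subst (λ k' → ¬ T (feasible k'))
        (trans (tallyAt-++ R rest PR Pr (true ∷ l) k)
               (cong (λ k' → tallyAt rest Pr (true ∷ l) (tallyAt R PR (true ∷ l) k'))
                     (sym (tallyAt-off true L PL l k offL)))) bad
...   | inj₂ refineDead = refine-sound f k L R rest refineDead PL PR Pr offL offR

refine-sound f k L R (m ∷ rest) unc PL PR (q ∷ Pr) offL offR with Equivalence.to T-∧ unc | off-either q
... | toLeft , _ | inj₁ off =
  let l , bad = split-sound f k (m ∷ L) R rest toLeft (q ∷ PL) PR Pr (off , offL) offR
  in  l , subst (λ k' → ¬ T (feasible (tallyAt rest Pr l k')))
            (trans (cong (tallyAt R PR l) (tallyAt-step L PL l (kind m) q l k))
                   (tallyAt-step R PR l (kind m) q l (tallyAt L PL l k))) bad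
... | _ , toRight | inj₂ off =
  let l , bad = split-sound f k L (m ∷ R) rest toRight PL (q ∷ PR) Pr offL (off , offR)
  in  l , subst (λ k' → ¬ T (feasible (tallyAt rest Pr l k'))) (tallyAt-step R PR l (kind m) q l (tallyAt L PL l k)) bad

%≡%-from-∣⊖∣ : ∀ {d} .{{_ : NonZero d}} m n → d ∣ ℤ.∣ m ⊖ n ∣ → m % d ≡ n % d
%≡%-from-∣⊖∣ {d} m n d∣ with ≤-<-connex n m
... | inj₁ n≤m = trans (cong (_% d) (sym (m+[n∸m]≡n n≤m))) (%-remove-+ʳ n (subst (d ∣_) (cong ℤ.∣_∣ (⊖-≥ n≤m)) d∣))
... | inj₂ m<n = sym (trans (cong (_% d) (sym (m+[n∸m]≡n (<⇒≤ m<n)))) (%-remove-+ʳ m (subst (d ∣_) (∣⊖∣-< m<n) d∣)))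

satisfies⇒%≡ : ∀ {n N} .{{_ : NonZero n}} .{{_ : NonZero N}} x r → n ∣ N → Satisfies (ℤ.+ x) (n , r) → x % n ≡ (r %ℕ N) % n
satisfies⇒%≡ {n} {N} x r n∣N sat =
  %≡%-from-∣⊖∣ x ρ (subst (λ z → n ∣ ℤ.∣ z ∣) (m-n≡m⊖n x ρ) (∣⇒∣ᵤ n∣x-ρ))
  where
  ρ = r %ℕ N
  q = r /ℕ N
  shift : (ℤ.+ x ℤ.- r) ℤ.+ q ℤ.* ℤ.+ N ≡ ℤ.+ x ℤ.- ℤ.+ ρ
  shift = subst (λ r' → (ℤ.+ x ℤ.- r') ℤ.+ q ℤ.* ℤ.+ N ≡ ℤ.+ x ℤ.- ℤ.+ ρ) (sym (a≡a%ℕn+[a/ℕn]*n r N))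
                (cancel (ℤ.+ x) (ℤ.+ ρ) q (ℤ.+ N))
    where
    cancel : ∀ x p q N → (x ℤ.- (p ℤ.+ q ℤ.* N)) ℤ.+ q ℤ.* N ≡ x ℤ.- p
    cancel = ℤ-Ring.solve-∀
  n∣x-ρ : ℤ.+ n ∣ℤ (ℤ.+ x ℤ.- ℤ.+ ρ)
  n∣x-ρ = subst (ℤ.+ n ∣ℤ_) shift (∣m∣n⇒∣m+n {m = ℤ.+ x ℤ.- r} (∣ᵤ⇒∣ sat) (∣n⇒∣m*n q (∣ᵤ⇒∣ n∣N)))

toBits-% : ∀ d s x .{{_ : NonZero (2 ^ d * s)}} → toBits d (x % (2 ^ d * s)) ≡ toBits d x
toBits-% d s x = sym (trans (cong (toBits d) split) (toBits-+* d (x % n) (x / n * s)))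
  where
  n = 2 ^ d * s
  split : x ≡ x % n + x / n * s * 2 ^ d
  split = trans (m≡m%n+[m/n]*n x n) (cong (λ k → x % n + k) (regroup (x / n) s (2 ^ d)))
    where
    regroup : ∀ q s p → q * (p * s) ≡ q * s * p
    regroup = ℕ-Ring.solve-∀

-- 225 ≡ 1 and 16 ≡ 0 modulo 16, while 225 ≡ 0 and 16 ≡ 1 modulo 15.
crt : ℕ → ℕ → ℕ
crt t u = 225 * t + 16 * u

toBits-crt : ∀ t u → toBits 4 (crt t u) ≡ toBits 4 t
toBits-crt t u = trans (cong (toBits 4) (regroup t u)) (toBits-+* 4 t (14 * t + u))
  where
  regroup : ∀ t u → 225 * t + 16 * u ≡ t + (14 * t + u) * 2 ^ 4
  regroup = ℕ-Ring.solve-∀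

crt-%15 : ∀ t {u} → u < 15 → crt t u % 15 ≡ u
crt-%15 t {u} u<15 = trans (cong (_% 15) (regroup t u)) (trans ([m+kn]%n≡m%n u (15 * t + u) 15) (m<n⇒m%n≡m u<15))
  where
  regroup : ∀ t u → 225 * t + 16 * u ≡ u + (15 * t + u) * 15
  regroup = ℕ-Ring.solve-∀

%-via-divisors : ∀ {s n} .{{_ : NonZero s}} .{{_ : NonZero n}} {x ρ u} → s ∣ n → s ∣ 15 →
  x % n ≡ ρ % n → x % 15 ≡ u → u % s ≡ ρ % s
%-via-divisors {s} {n} {x} {ρ} {u} s∣n s∣15 x≡ρ x≡u = begin
  u % s          ≡⟨ cong (_% s) x≡u ⟨
  x % 15 % s     ≡⟨ m∣n⇒o%n%m≡o%m s 15 x s∣15 ⟩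
  x % s          ≡⟨ m∣n⇒o%n%m≡o%m s n x s∣n ⟨
  x % n % s      ≡⟨ cong (_% s) x≡ρ ⟩
  ρ % n % s      ≡⟨ m∣n⇒o%n%m≡o%m s n ρ s∣n ⟩
  ρ % s          ∎
  where open ≡-Reasoning

∣lcmModuli : ∀ cs {n} → n ∈ moduli cs → n ∣ lcmModuli cs
∣lcmModuli ((m , _) ∷ cs) (here refl) = m∣lcm[m,n] m (lcmModuli cs)
∣lcmModuli ((m , _) ∷ cs) (there n∈) = ∣-trans (∣lcmModuli cs n∈) (n∣lcm[m,n] m (lcmModuli cs))

residueFor : ℕ → List Congruence → Maybe ℤ
residueFor n []              = nothing
residueFor n ((n' , r) ∷ cs) = if does (n ≟ n') then just r else residueFor n cs

residueFor-unique : ∀ cs {n r} → Unique (moduli cs) → (n , r) ∈ cs → residueFor n cs ≡ just r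
residueFor-unique ((n , r) ∷ cs) _ (here refl) rewrite dec-true (n ≟ n) refl = refl
residueFor-unique ((n' , r') ∷ cs) {n} (n'∉ ∷ unique) (there c∈)
  rewrite dec-false (n ≟ n') (λ { refl → All.lookup n'∉ (∈-map⁺ proj₁ c∈) refl }) = residueFor-unique cs unique c∈

slotModulus : Slot → ℕ
slotModulus m = 2 ^ suc (level m) * value (kind m)

-- Every modulus divides 240, so reducing modulo 240 loses nothing.
residue : ℤ → ℕ
residue r = r %ℕ 240

path : (m : Slot) → ℤ → Path m
path m r = toBits (suc (level m)) (residue r)

placementOf : List Congruence → (S : List Slot) → Placement S
placementOf cs []      = []
placementOf cs (m ∷ S) = Maybe.map (path m) (residueFor (slotModulus m) cs) ∷ placementOf cs S

pinFor : OddPart → Maybe ℤ → List Pin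
pinFor t nothing  = []
pinFor t (just r) = (t , residue r) ∷ []

pinsAt : ∀ {f} → List Congruence → List Slot → Vec Bool f → List Pin
pinsAt cs []      l = []
pinsAt cs (m ∷ S) l = (if applies q l then pinFor (kind m) (residueFor (slotModulus m) cs) else []) ++ pinsAt cs S l
  where q = Maybe.map (path m) (residueFor (slotModulus m) cs)

tallyAt-pinsAt : ∀ {f} cs S (l : Vec Bool f) k → tallyAt S (placementOf cs S) l k ≡ addPins k (pinsAt cs S l)
tallyAt-pinsAt cs []      l k = refl
tallyAt-pinsAt cs (m ∷ S) l k with residueFor (slotModulus m) cs
... | nothing = tallyAt-pinsAt cs S l k
... | just r with path m r ≼ᵇ l
...   | true  = tallyAt-pinsAt cs S l (bump k (kind m))
...   | false = tallyAt-pinsAt cs S l k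

∈-pinsAt : ∀ {f} cs S (l : Vec Bool f) {m r} → m ∈ S → residueFor (slotModulus m) cs ≡ just r → T (path m r ≼ᵇ l) →
  (kind m , residue r) ∈ pinsAt cs S l
∈-pinsAt cs (m ∷ S) l (here refl) found p≼l rewrite found | Equivalence.to T-≡ p≼l = here refl
∈-pinsAt cs (m ∷ S) l (there m∈) found p≼l = ∈-++⁺ʳ _ (∈-pinsAt cs S l m∈ found p≼l)

rootPins : List Congruence → List Pin
rootPins cs = pinFor five (residueFor 5 cs) ++ pinFor fifteen (residueFor 15 cs)

addPins-pinFor : ∀ {k k'} t q → k ≤ᵀ k' → addPins k (pinFor t q) ≤ᵀ bump k' t
addPins-pinFor t nothing  k≤k' = ≤ᵀ-trans k≤k' (≤ᵀ-bump _ t)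
addPins-pinFor t (just r) k≤k' = bump-mono t k≤k'

-- The moduli 5 and 15 fix no binary digit, so they are credited at every leaf.
rootTally : Tally
rootTally = tally 0 0 1 1

coveredPins : ∀ {f} → List Congruence → List Slot → Vec Bool f → List Pin
coveredPins cs S l = rootPins cs ++ pinsAt cs S l

coveredPins≤tallyAt : ∀ {f} cs S (l : Vec Bool f) →
  addPins ∅ (coveredPins cs S l) ≤ᵀ tallyAt S (placementOf cs S) l rootTally
coveredPins≤tallyAt cs S l =
  subst (_≤ᵀ tallyAt S P l rootTally)
        (sym (trans (addPins-++ ∅ (rootPins cs) (pinsAt cs S l)) (sym (tallyAt-pinsAt cs S l _))))
        (tallyAt-mono S P l rootPins≤rootTally)
  where
  P = placementOf cs S
  rootPins≤rootTally : addPins ∅ (rootPins cs) ≤ᵀ rootTally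
  rootPins≤rootTally = subst (_≤ᵀ rootTally) (sym (addPins-++ ∅ (pinFor five (residueFor 5 cs)) _))
    (addPins-pinFor fifteen (residueFor 15 cs) (addPins-pinFor five (residueFor 5 cs) ≤ᵀ-refl))

slots : List Slot
slots = slot 3 one ∷ slot 3 three ∷ slot 3 five ∷ slot 3 fifteen ∷ slot 2 one ∷ slot 2 three ∷ slot 2 five ∷ slot 2 fifteen ∷
        slot 1 one ∷ slot 1 three ∷ slot 1 five ∷ slot 1 fifteen ∷ slot 0 three ∷ slot 0 five ∷ slot 0 fifteen ∷ []

divisors-of-240 : ∀ {n} → n < 241 → 4 ≤ n → n ∣ 240 → n ∈ 5 ∷ 15 ∷ map slotModulus slots
divisors-of-240 = from-yes (allUpTo? (λ n → 4 ≤? n →-dec (n ∣? 240 →-dec n ∈? 5 ∷ 15 ∷ map slotModulus slots)) 241)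

congruent⇒¬Avoids : ∀ t d {x ρ u} .{{_ : NonZero (2 ^ d * value t)}} →
  x % (2 ^ d * value t) ≡ ρ % (2 ^ d * value t) → x % 15 ≡ u → ¬ Avoids u (t , ρ)
congruent⇒¬Avoids one     d {x} {ρ} {u} _   _   avoids = avoids (trans (n%1≡0 u) (sym (n%1≡0 ρ)))
congruent⇒¬Avoids three   d x≡ρ x≡u avoids = avoids (%-via-divisors (n∣m*n (2 ^ d)) (divides 5 refl) x≡ρ x≡u)
congruent⇒¬Avoids five    d x≡ρ x≡u avoids = avoids (%-via-divisors (n∣m*n (2 ^ d)) (divides 3 refl) x≡ρ x≡u)
congruent⇒¬Avoids fifteen d x≡ρ x≡u avoids = avoids (%-via-divisors (n∣m*n (2 ^ d)) (divides 1 refl) x≡ρ x≡u)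

levels≤4 : All (λ m → suc (level m) ≤ 4) slots
levels≤4 = from-yes (All.all? {P = λ m → suc (level m) ≤ 4} (λ m → suc (level m) ≤? 4) slots)

path≼leaf : ∀ m {x r} .{{_ : NonZero (slotModulus m)}} → suc (level m) ≤ 4 →
  x % slotModulus m ≡ residue r % slotModulus m → T (path m r ≼ᵇ toBits 4 x)
path≼leaf m {x} {r} d≤4 x≡ρ = subst (λ p → T (p ≼ᵇ toBits 4 x)) same (toBits-≼ x d≤4)
  where
  d = suc (level m)
  s = value (kind m)
  same : toBits d x ≡ toBits d (residue r)
  same = trans (sym (toBits-% d s x)) (trans (cong (toBits d) x≡ρ) (toBits-% d s (residue r)))

listed⇒¬AllAvoid : ∀ cs l {x u n r} .{{_ : NonZero n}} → n ∈ 5 ∷ 15 ∷ map slotModulus slots → residueFor n cs ≡ just r →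
  x % n ≡ residue r % n → x % 15 ≡ u → toBits 4 x ≡ l → ¬ All (Avoids u) (coveredPins cs slots l)
listed⇒¬AllAvoid cs l {x} {u} {r = r} (here refl) found x≡ρ x≡u leaf avoided =
  congruent⇒¬Avoids five 0 {x} {residue r} {u} x≡ρ x≡u
    (All.lookup avoided (∈-++⁺ˡ (∈-++⁺ˡ (subst (λ q → (five , residue r) ∈ pinFor five q) (sym found) (here refl)))))
listed⇒¬AllAvoid cs l {x} {u} {r = r} (there (here refl)) found x≡ρ x≡u leaf avoided =
  congruent⇒¬Avoids fifteen 0 {x} {residue r} {u} x≡ρ x≡u
    (All.lookup avoided (∈-++⁺ˡ (∈-++⁺ʳ (pinFor five (residueFor 5 cs))
      (subst (λ q → (fifteen , residue r) ∈ pinFor fifteen q) (sym found) (here refl)))))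
listed⇒¬AllAvoid cs l {x} {u} {r = r} (there (there n∈)) found x≡ρ x≡u leaf avoided with ∈-map⁻ slotModulus {xs = slots} n∈
... | m , m∈ , refl =
  congruent⇒¬Avoids (kind m) (suc (level m)) {x} {residue r} {u} x≡ρ x≡u
    (All.lookup avoided (∈-++⁺ʳ (rootPins cs) (∈-pinsAt cs slots l m∈ found
      (subst (λ l′ → T (path m r ≼ᵇ l′)) leaf (path≼leaf m {x} {r} (All.lookup levels≤4 m∈) x≡ρ)))))

satisfied⇒¬AllAvoid : ∀ cs l u → Unique (moduli cs) → All (4 ≤_) (moduli cs) → lcmModuli cs ≡ 240 → u < 15 →
  ∀ {n r} → (n , r) ∈ cs → Satisfies (ℤ.+ crt (fromBits l) u) (n , r) → ¬ All (Avoids u) (coveredPins cs slots l)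
satisfied⇒¬AllAvoid cs l u unique atLeast4 lcm≡240 u<15 {n} {r} c∈ sat =
  listed⇒¬AllAvoid cs l (divisors-of-240 (s≤s (∣⇒≤ n∣240)) 4≤n n∣240) (residueFor-unique cs unique c∈)
    (satisfies⇒%≡ x r n∣240 sat) (crt-%15 (fromBits l) u<15) (trans (toBits-crt (fromBits l) u) (toBits-fromBits l))
  where
  x = crt (fromBits l) u
  n∈ = ∈-map⁺ proj₁ c∈
  4≤n = All.lookup atLeast4 n∈
  instance
    n≢0 : NonZero n
    n≢0 = >-nonZero (≤-trans (s≤s z≤n) 4≤n)
  n∣240 : n ∣ 240
  n∣240 = subst (n ∣_) lcm≡240 (∣lcmModuli cs n∈)

-- abstract, so that type checking the rest never unfolds the search again.
abstract
  slots-uncoverable : Uncoverable 4 rootTally slots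
  slots-uncoverable = uncoverable-sound 4 rootTally slots refl

lemma7 : (cs : List Congruence) →
    ¬ (IsDistinctCovering cs × LeastModulus cs 4 × lcmModuli cs ≡ 240)
lemma7 cs (((_ , covers) , unique , _) , (_ , atLeast4) , lcm≡240) =
  let l , infeasible = slots-uncoverable (placementOf cs slots)
      u , u<15 , avoided =
        infeasible⇒escape (coveredPins cs slots l) (infeasible ∘ feasible-mono (coveredPins≤tallyAt cs slots l))
      _ , c∈ , sat = find (covers (ℤ.+ crt (fromBits l) u))
  in  satisfied⇒¬AllAvoid cs l u unique atLeast4 lcm≡240 u<15 c∈ sat avoided
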